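{- Order the homsets of the Kleisli category of $\widetilde{PP^+}$ pointwise by inclusion, with joins $(\bigvee_if_i)(x)=\mathsf{cl}(\bigcup_if_i(x))$. Then Kleisli composition does not preserve joins of $\omega$-chains in its first argument: there exist sets $X,Y,Z$, a map $f:X\to\widetilde{PP^+}(Y)$ and an increasing chain $g_0\sqsubseteq g_1\sqsubseteq\cdots$ of maps $Y\to\widetilde{PP^+}(Z)$ such that $(\bigvee_ig_i)\odot f\neq\bigvee_i(g_i\odot f)$. Hence $\mathbf{Kl}(\widetilde{PP^+})$ is not $\omega$-cpo-enriched with respect to this order.
   Context: $P^+$ is the non-empty powerset monad on Set ($P^+(X)$ = non-empty subsets of $X$, unit $x\mapsto\{x\}$, multiplication union). The weak distributive law $\delta:P^+P\to PP^+$ is $\delta(\{U_i\}_{i\in I})=\{\bigcup_{i\in I}V_i\mid\emptyset\neq V_i\subseteq U_i\}$; the associated convex closure is $\mathsf{cl}(\mathcal U)=\{\bigcup\mathcal V\mid\emptyset\neq\mathcal V\subseteq\mathcal U\}$ for $\mathcal U\subseteq P^+(X)$, and $\widetilde{PP^+}(X)=\{\mathcal U\subseteq P^+(X)\mid\mathsf{cl}(\mathcal U)=\mathcal U\}$ (sets of non-empty subsets closed under non-empty unions). $\widetilde{PP^+}$ is a monad with unit $x\mapsto\{\{x\}\}$; its Kleisli composition is $(g\odot f)(x)=\{\bigcup_{y\in U}\bigcup\mathcal V_y\mid U\in f(x),\ \emptyset\neq\mathcal V_y\subseteq g(y)\text{ for each }y\in U\}$. A category is $\omega$-cpo-enriched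 if homsets are partial orders with joins of $\omega$-chains and composition preserves such joins in each argument. -}

module Defs where

open import Level using (Level; 0ℓ; _⊔_) renaming (suc to lsuc)
open import Data.Nat using (ℕ; suc)
open import Data.Product using (Σ; ∃; _×_; _,_)
open import Relation.Unary using (Pred)

-- Subsets of a set X are predicates  X → Set.
-- Families of subsets (subsets of P(X)) are predicates on  Pred X 0ℓ,
-- living in  Set₁  (needed so that cl and ⊙ do not raise universe levels).

NonEmpty : {X : Set} → Pred X 0ℓ → Set
NonEmpty {X} U = Σ X U

_⊆'_ : {A : Set₁} → (A → Set) → (A → Set₁) → Set₁
_⊆'_ {A} P Q = ∀ (x : A) → P x → Q x

_≐₀_ : {X : Set} {a : Level} → Pred X 0ℓ → (X → Set a) → Set a
_≐₀_ {X} W V = (∀ x → W x → V x) × (∀ x → V x → W x)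

Fam : Set → Set₂
Fam X = Pred X 0ℓ → Set₁

⋃ᶠ : {X : Set} → (Pred X 0ℓ → Set) → X → Set₁
⋃ᶠ {X} 𝒱 x = Σ (Pred X 0ℓ) λ V → 𝒱 V × V x

cl : {X : Set} → Fam X → Fam X
cl {X} 𝒰 W = Σ (Pred X 0ℓ → Set) λ 𝒱 →
  (𝒱 ⊆' 𝒰) × (Σ (Pred X 0ℓ) 𝒱) × (W ≐₀ ⋃ᶠ 𝒱)

_≋_ : {X : Set} → Fam X → Fam X → Set₁
_≋_ {X} 𝒰 𝒲 = (∀ W → 𝒰 W → 𝒲 W) × (∀ W → 𝒲 W → 𝒰 W)

IsPPt : {X : Set} → Fam X → Set₁
IsPPt {X} 𝒰 = (∀ U → 𝒰 U → NonEmpty U) × (cl 𝒰 ≋ 𝒰)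

record KlArr (X Y : Set) : Set₂ where
  field
    fam   : X → Fam Y
    isPPt : ∀ x → IsPPt (fam x)
open KlArr public

_⊑_ : {X Y : Set} → (X → Fam Y) → (X → Fam Y) → Set₁
_⊑_ {X} {Y} f g = ∀ x (U : Pred Y 0ℓ) → f x U → g x U

⋁ : {Y Z : Set} → (ℕ → Y → Fam Z) → Y → Fam Z
⋁ g y = cl (λ W → Σ ℕ λ i → g i y W)

_⊙_ : {X Y Z : Set} → (Y → Fam Z) → (X → Fam Y) → X → Fam Z
_⊙_ {X} {Y} {Z} g f x W =
  Σ (Pred Y 0ℓ) λ U → f x U ×
  Σ ((y : Y) → U y → Pred Z 0ℓ → Set) λ 𝒱 →
    (∀ y (u : U y) → 𝒱 y u ⊆' g y) ×
    (∀ y (u : U y) → Σ (Pred Z 0ℓ) (𝒱 y u)) ×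
    (W ≐₀ (λ z → Σ Y λ y → Σ (U y) λ u → ⋃ᶠ (𝒱 y u) z))

IsChain : {Y Z : Set} → (ℕ → Y → Fam Z) → Set₁
IsChain g = ∀ i → g i ⊑ g (suc i)

-- Take f : ⊤ → PP̃⁺(ℕ) picking the whole of ℕ, and gᵢ(y) = {⊤} if y < i, else ∅.
-- Every y ∈ ℕ is eventually below i, so (⋁ᵢ gᵢ)(y) = {⊤} everywhere and (⋁ᵢ gᵢ) ⊙ f
-- contains ⊤.  But composing with f needs a non-empty choice at every y ∈ ℕ, and
-- gᵢ(i) = ∅, so each gᵢ ⊙ f is empty, and so is the closure of their union.
module Submission where

open import Defs
open import Level using (Lift; lift; lower; 0ℓ) renaming (suc to lsuc)
open import Data.Nat using (ℕ; suc; _<_)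
open import Data.Nat.Properties using (<-irrefl; m<n⇒m<1+n; n<1+n)
open import Data.Product using (Σ; _×_; _,_; proj₁; proj₂)
open import Data.Unit using (⊤; tt)
open import Relation.Nullary using (¬_)
open import Relation.Binary.PropositionalEquality using (refl)
open import Relation.Unary using (Pred)

Full : {A : Set} → Pred A 0ℓ → Set
Full {A} W = ∀ a → W a

IsEmpty : {A : Set} → Fam A → Set₁
IsEmpty 𝒰 = ∀ W → ¬ 𝒰 W

-- The family {A} when P holds and ∅ otherwise (up to extensional equality of subsets).
fullIf : {A : Set} → Set → Fam A
fullIf P W = Lift (lsuc 0ℓ) (P × Full W)

fullIf-mono : {A X : Set} {P Q : X → Set} →
  (∀ x → P x → Q x) → (λ x → fullIf {A} (P x)) ⊑ (λ x → fullIf (Q x))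
fullIf-mono P⇒Q x U (lift (p , full)) = lift (P⇒Q x p , full)

cl-full : {A : Set} {𝒰 : Fam A} →
  (∀ W → Full W → 𝒰 W) → ∀ W → Full W → cl 𝒰 W
cl-full 𝒰⊇full W full =
  Full , 𝒰⊇full , ((λ _ → ⊤) , λ _ → tt) , (λ a w → W , full , w) , (λ a _ → full a)

cl-fullIf : {A : Set} {P : Set} → ∀ W → cl (fullIf {A} P) W → fullIf P W
cl-fullIf W (𝒱 , 𝒱⊆ , (V , v) , _ , ⋃𝒱⊆W) with 𝒱⊆ V v
... | lift (p , fullV) = lift (p , λ a → ⋃𝒱⊆W a (V , v , fullV a))

fullIf-isPPt : {A : Set} → A → (P : Set) → IsPPt (fullIf {A} P)
fullIf-isPPt a P =
  (λ U u → a , proj₂ (lower u) a) ,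
  cl-fullIf ,
  (λ W w → cl-full (λ V full → lift (proj₁ (lower w) , full)) W (proj₂ (lower w)))

fullArr : {X A : Set} → A → (X → Set) → KlArr X A
fullArr a P = record { fam = λ x → fullIf (P x) ; isPPt = λ x → fullIf-isPPt a (P x) }

cl-empty : {A : Set} {𝒰 : Fam A} → IsEmpty 𝒰 → IsEmpty (cl 𝒰)
cl-empty 𝒰-empty W (𝒱 , 𝒱⊆𝒰 , (V , v) , _) = 𝒰-empty V (𝒱⊆𝒰 V v)

⊙-full : {X Y Z : Set} {g : Y → Fam Z} {f : X → Fam Y} {x : X} → Y →
  (∀ y W → Full W → g y W) → (U : Pred Y 0ℓ) → Full U → f x U →
  ∀ W → Full W → (g ⊙ f) x W
⊙-full y₀ g⊇full U fullU fxU W fullW =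
  U , fxU , (λ _ _ → Full) , (λ y _ → g⊇full y) , (λ _ _ → (λ _ → ⊤) , λ _ → tt) ,
  (λ z w → y₀ , fullU y₀ , W , fullW , w) , (λ z _ → fullW z)

-- A composite is empty as soon as every U ∈ f x meets a point where g is empty,
-- since ⊙ must choose a non-empty subfamily of g y at every y ∈ U.
⊙-empty : {X Y Z : Set} {g : Y → Fam Z} {f : X → Fam Y} {x : X} →
  (∀ U → f x U → Σ Y λ y → U y × IsEmpty (g y)) → IsEmpty ((g ⊙ f) x)
⊙-empty meets-empty W (U , fxU , 𝒱 , 𝒱⊆g , 𝒱-nonEmpty , _) with meets-empty U fxU
... | y , u , gy-empty with 𝒱-nonEmpty y u
...   | V , v = gy-empty V (𝒱⊆g y u V v)

below : ℕ → KlArr ℕ ⊤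
below i = fullArr tt (_< i)

whole : KlArr ⊤ ℕ
whole = fullArr 0 (λ _ → ⊤)

mainTheorem12 : Σ Set λ X → Σ Set λ Y → Σ Set λ Z →
    Σ (KlArr X Y) λ f → Σ (ℕ → KlArr Y Z) λ g →
    IsChain (λ i → fam (g i)) ×
    ¬ (∀ x → (⋁ (λ i → fam (g i)) ⊙ fam f) x ≋ ⋁ (λ i → (fam (g i) ⊙ fam f)) x)
mainTheorem12 =
  ⊤ , ℕ , ⊤ , whole , below ,
  (λ i → fullIf-mono (λ y → m<n⇒m<1+n)) ,
  λ joins-agree → ⋁-empty (λ _ → ⊤) (proj₁ (joins-agree tt) (λ _ → ⊤) ⋁⊙whole-full)
  where
  ⋁below-full : ∀ y W → Full W → ⋁ (λ i → fam (below i)) y W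
  ⋁below-full y = cl-full (λ W full → suc y , lift (n<1+n y , full))

  ⋁⊙whole-full : (⋁ (λ i → fam (below i)) ⊙ fam whole) tt (λ _ → ⊤)
  ⋁⊙whole-full =
    ⊙-full {f = fam whole} 0 ⋁below-full (λ _ → ⊤) (λ _ → tt) (lift (tt , λ _ → tt)) (λ _ → ⊤) (λ _ → tt)

  below⊙whole-empty : ∀ i → IsEmpty ((fam (below i) ⊙ fam whole) tt)
  below⊙whole-empty i = ⊙-empty {g = fam (below i)} {f = fam whole} λ U wholeU →
    i , proj₂ (lower wholeU) i , λ V gᵢi → <-irrefl refl (proj₁ (lower gᵢi))

  ⋁-empty : IsEmpty (⋁ (λ i → fam (below i) ⊙ fam whole) tt)
  ⋁-empty = cl-empty λ W (i , w) → below⊙whole-empty i W w
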